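{- Let $P_0$ be the set of all primes congruent to $3$ modulo $8$. For $n\ge1$ let $P_n$ be the set of primes $p\in P_{n-1}$ such that all prime factors of $\frac{p-1}{2}$ lie in $P_{n-1}$, and let $P_\infty=\bigcap_{n\ge0}P_n$. Then a prime $p$ divides some Nov\'ak number $N$ for which $2N$ is a Nov\'ak--Carmichael number if and only if $p\in P_\infty$.
   Context: A Nov\'ak number is a positive integer $N$ with $N\mid 2^N+1$. A positive integer $M$ is a Nov\'ak--Carmichael number if $M$ divides $a^M-1$ for every integer $a$ coprime to $M$. -}

module Defs where

open import Data.Nat using (ℕ; zero; suc; _^_; _∸_; _%_; _/_; _*_; _≥_)
open import Data.Nat.Divisibility using (_∣_)
open import Data.Nat.Coprimality using (Coprime)
open import Data.Nat.Primality using (Prime)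
open import Data.Product using (_×_)
open import Relation.Binary.PropositionalEquality using (_≡_)

Novak : ℕ → Set
Novak N = N ≥ 1 × N ∣ suc (2 ^ N)

-- It suffices (and is equivalent) to quantify over natural a, since the condition
-- only depends on a mod M; a^M ∸ 1 is the true difference whenever a ≥ 1,
-- and a = 0 is coprime to M only for M = 1, where divisibility is trivial.
NovakCarmichael : ℕ → Set
NovakCarmichael M = M ≥ 1 × ((a : ℕ) → Coprime a M → M ∣ (a ^ M ∸ 1))

P : ℕ → ℕ → Set
P zero p = Prime p × p % 8 ≡ 3
P (suc n) p = P n p × ((q : ℕ) → Prime q → q ∣ ((p ∸ 1) / 2) → P n q)

P∞ : ℕ → Set
P∞ p = (n : ℕ) → P n p

-- If p divides N, the Novák–Carmichael property of 2N, applied to lifts of the units of ℤ/p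
-- that are coprime to 2N, makes 2N a multiple of the exponent p − 1 of (ℤ/p)ˣ; so (p − 1)/2
-- divides N and is odd. If p ≡ 7 mod 8, Gauss's lemma gives 2^((p−1)/2) ≡ 1 mod p and hence
-- 2^N ≡ 1 instead of −1; so p ≡ 3 mod 8, and the prime factors of (p − 1)/2 again divide N.
--
-- Conversely, call N admissible if it is odd and every prime q ∣ N has q ≡ 3 mod 8 and
-- (q − 1)/2 ∣ N. Every p ∈ P∞ divides an admissible number (strong induction through the
-- prime factors of (p − 1)/2). For admissible N and qᵉ ∣ N, Gauss's lemma gives
-- 2^((q−1)/2) ≡ −1 mod q, lifting the exponent gives 2^N ≡ −1 mod qᵉ, and Fermat's little
-- theorem with the same lifting gives a^(2N) ≡ 1 mod qᵉ, since φ(qᵉ) divides 2N.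

module Submission where

open import Defs

module Congruence where

  open import Data.Nat as ℕ using (ℕ; zero; suc)
  open import Data.Nat.GCD using (gcd; gcd-GCD; module Bézout)
  import Data.Nat.Divisibility as ℕ
  open import Data.Nat.Primality using (Prime; euclidsLemma)
  open import Data.Sum using (inj₁; inj₂)
  open import Relation.Nullary using (¬_; contradiction)
  import Data.Nat.Properties as ℕ
  open import Data.Integer hiding (suc; pred)
  open import Data.Integer.Properties
  open import Data.Integer.Divisibility.Signed
  open import Data.Integer.Tactic.RingSolver using (solve-∀)
  open import Relation.Binary.Bundles using (Setoid)
  open import Relation.Binary.PropositionalEquality

  infix 4 _≡_mod_

  record _≡_mod_ (x y n : ℤ) : Set where
    constructor congruent
    field divides-difference : n ∣ x - y

  open _≡_mod_ public

  private
    variable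
      k n x y z u v : ℤ

  ≡mod-refl : x ≡ x mod n
  ≡mod-refl {x} {n} = congruent (subst (n ∣_) (sym (lemma x)) (divides 0ℤ (sym (*-zeroˡ n))))
    where lemma : ∀ x → x - x ≡ 0ℤ
          lemma = solve-∀

  ≡mod-sym : x ≡ y mod n → y ≡ x mod n
  ≡mod-sym {x} {y} {n} (congruent d) = congruent (subst (n ∣_) (lemma x y) (∣m⇒∣-m d))
    where lemma : ∀ x y → - (x - y) ≡ y - x
          lemma = solve-∀

  ≡mod-trans : x ≡ y mod n → y ≡ z mod n → x ≡ z mod n
  ≡mod-trans {x} {y} {n} {z} (congruent d) (congruent e) =
    congruent (subst (n ∣_) (lemma x y z) (∣m∣n⇒∣m+n d e))
    where lemma : ∀ x y z → (x - y) + (y - z) ≡ x - z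
          lemma = solve-∀

  ≡mod-setoid : ℤ → Setoid _ _
  ≡mod-setoid n = record
    { Carrier = ℤ
    ; _≈_ = λ x y → x ≡ y mod n
    ; isEquivalence = record { refl = ≡mod-refl ; sym = ≡mod-sym ; trans = ≡mod-trans }
    }

  module ≡mod-Reasoning (n : ℤ) where
    open import Relation.Binary.Reasoning.Setoid (≡mod-setoid n) public

  ∣⇒≡0[mod] : n ∣ x → x ≡ 0ℤ mod n
  ∣⇒≡0[mod] {n} {x} d = congruent (subst (n ∣_) (sym (+-identityʳ x)) d)

  ≡0[mod]⇒∣ : x ≡ 0ℤ mod n → n ∣ x
  ≡0[mod]⇒∣ {x} {n} (congruent d) = subst (n ∣_) (+-identityʳ x) d

  ≡mod-weaken : k ∣ n → x ≡ y mod n → x ≡ y mod k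
  ≡mod-weaken k∣n (congruent d) = congruent (∣-trans k∣n d)

  +-cong-mod : x ≡ y mod n → u ≡ v mod n → x + u ≡ y + v mod n
  +-cong-mod {x} {y} {n} {u} {v} (congruent d) (congruent e) =
    congruent (subst (n ∣_) (lemma x y u v) (∣m∣n⇒∣m+n d e))
    where lemma : ∀ x y u v → (x - y) + (u - v) ≡ (x + u) - (y + v)
          lemma = solve-∀

  *-cong-mod : x ≡ y mod n → u ≡ v mod n → x * u ≡ y * v mod n
  *-cong-mod {x} {y} {n} {u} {v} (congruent d) (congruent e) =
    congruent (subst (n ∣_) (lemma x y u v) (∣m∣n⇒∣m+n (∣m⇒∣m*n u d) (∣n⇒∣m*n y e)))
    where lemma : ∀ x y u v → (x - y) * u + y * (u - v) ≡ x * u - y * v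
          lemma = solve-∀

  neg-cong-mod : x ≡ y mod n → - x ≡ - y mod n
  neg-cong-mod {x} {y} {n} (congruent d) = congruent (subst (n ∣_) (lemma x y) (∣m⇒∣-m d))
    where lemma : ∀ x y → - (x - y) ≡ - x - - y
          lemma = solve-∀

  complement-mod : ∀ {a b p} → a ℕ.+ b ≡ p → + a ≡ - + b mod + p
  complement-mod {a} {b} {p} a+b≡p = congruent (divides 1ℤ (begin
    + a - - + b   ≡⟨ cong (λ y → + a + y) (neg-involutive (+ b)) ⟩
    + a + + b     ≡⟨ pos-+ a b ⟨
    + (a ℕ.+ b)   ≡⟨ cong +_ a+b≡p ⟩
    + p           ≡⟨ *-identityˡ (+ p) ⟨
    1ℤ * + p      ∎))
    where open ≡-Reasoning

  +-modulus : x + n ≡ x mod n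
  +-modulus {x} {n} = congruent (divides 1ℤ (lemma x n))
    where lemma : ∀ x n → x + n - x ≡ 1ℤ * n
          lemma = solve-∀

  pos-^ : ∀ a e → + (a ℕ.^ e) ≡ (+ a) ^ e
  pos-^ a zero    = refl
  pos-^ a (suc e) = trans (pos-* a (a ℕ.^ e)) (cong (+ a *_) (pos-^ a e))

  pos-∸1 : ∀ {x} → 1 ℕ.≤ x → + (x ℕ.∸ 1) ≡ + x - 1ℤ
  pos-∸1 {x} 1≤x = sym (trans (m-n≡m⊖n x 1) (⊖-≥ 1≤x))

  ∣∸1⇒≡1[mod] : ∀ {x n} → 1 ℕ.≤ x → n ℕ.∣ x ℕ.∸ 1 → + x ≡ 1ℤ mod + n
  ∣∸1⇒≡1[mod] 1≤x n∣x∸1 = congruent (subst (_ ∣_) (pos-∸1 1≤x) (∣ᵤ⇒∣ n∣x∸1))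

  ≡1[mod]⇒∣∸1 : ∀ {x n} → 1 ℕ.≤ x → + x ≡ 1ℤ mod + n → n ℕ.∣ x ℕ.∸ 1
  ≡1[mod]⇒∣∸1 1≤x (congruent n∣x-1) = ∣⇒∣ᵤ (subst (_ ∣_) (sym (pos-∸1 1≤x)) n∣x-1)

  ∣1+⇒≡-1[mod] : ∀ {x n} → n ℕ.∣ suc x → + x ≡ -1ℤ mod + n
  ∣1+⇒≡-1[mod] {x} {n} n∣1+x = congruent (subst (+ n ∣_) (+-comm 1ℤ (+ x)) (∣ᵤ⇒∣ n∣1+x))

  ≡-1[mod]⇒∣1+ : ∀ {x n} → + x ≡ -1ℤ mod + n → n ℕ.∣ suc x
  ≡-1[mod]⇒∣1+ {x} {n} (congruent n∣x+1) = ∣⇒∣ᵤ (subst (+ n ∣_) (+-comm (+ x) 1ℤ) n∣x+1)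

  ^-cong-mod : ∀ e → x ≡ y mod n → x ^ e ≡ y ^ e mod n
  ^-cong-mod zero    _   = ≡mod-refl
  ^-cong-mod (suc e) x≡y = *-cong-mod x≡y (^-cong-mod e x≡y)

  -1^[2k]≡1 : ∀ k → -1ℤ ^ (2 ℕ.* k) ≡ 1ℤ
  -1^[2k]≡1 k = begin
    -1ℤ ^ (2 ℕ.* k)   ≡⟨ ^-*-assoc -1ℤ 2 k ⟨
    (-1ℤ ^ 2) ^ k     ≡⟨ ^-zeroˡ k ⟩
    1ℤ                ∎
    where open ≡-Reasoning

  -1^[1+2k]≡-1 : ∀ k → -1ℤ ^ suc (2 ℕ.* k) ≡ -1ℤ
  -1^[1+2k]≡-1 k = cong (-1ℤ *_) (-1^[2k]≡1 k)

  ^≡1⇒^*≡1 : ∀ a k → x ^ a ≡ 1ℤ mod n → x ^ (a ℕ.* k) ≡ 1ℤ mod n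
  ^≡1⇒^*≡1 {x} {n} a k xᵃ≡1 = begin
    x ^ (a ℕ.* k)  ≡⟨ ^-*-assoc x a k ⟨
    (x ^ a) ^ k    ≈⟨ ^-cong-mod k xᵃ≡1 ⟩
    1ℤ ^ k         ≡⟨ ^-zeroˡ k ⟩
    1ℤ             ∎
    where open ≡mod-Reasoning n

  ^≡-1⇒^*odd≡-1 : ∀ a k → x ^ a ≡ -1ℤ mod n → x ^ (a ℕ.* suc (2 ℕ.* k)) ≡ -1ℤ mod n
  ^≡-1⇒^*odd≡-1 {x} {n} a k xᵃ≡-1 = begin
    x ^ (a ℕ.* suc (2 ℕ.* k))  ≡⟨ ^-*-assoc x a (suc (2 ℕ.* k)) ⟨
    (x ^ a) ^ suc (2 ℕ.* k)    ≈⟨ ^-cong-mod (suc (2 ℕ.* k)) xᵃ≡-1 ⟩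
    -1ℤ ^ suc (2 ℕ.* k)        ≡⟨ -1^[1+2k]≡-1 k ⟩
    -1ℤ                        ∎
    where open ≡mod-Reasoning n

  ^≡1-combination : ∀ a b c k l → x ^ a ≡ 1ℤ mod n → x ^ b ≡ 1ℤ mod n →
                    c ℕ.+ a ℕ.* k ≡ b ℕ.* l → x ^ c ≡ 1ℤ mod n
  ^≡1-combination {x} {n} a b c k l xᵃ≡1 xᵇ≡1 eq = begin
    x ^ c                    ≡⟨ *-identityʳ (x ^ c) ⟨
    x ^ c * 1ℤ               ≈⟨ *-cong-mod (≡mod-refl {x ^ c}) (≡mod-sym (^≡1⇒^*≡1 a k xᵃ≡1)) ⟩
    x ^ c * x ^ (a ℕ.* k)    ≡⟨ ^-distribˡ-+-* x c (a ℕ.* k) ⟨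
    x ^ (c ℕ.+ a ℕ.* k)      ≡⟨ cong (x ^_) eq ⟩
    x ^ (b ℕ.* l)            ≈⟨ ^≡1⇒^*≡1 b l xᵇ≡1 ⟩
    1ℤ                       ∎
    where open ≡mod-Reasoning n

  ^≡1⇒^gcd≡1 : ∀ a b → x ^ a ≡ 1ℤ mod n → x ^ b ≡ 1ℤ mod n → x ^ gcd a b ≡ 1ℤ mod n
  ^≡1⇒^gcd≡1 a b xᵃ≡1 xᵇ≡1 with Bézout.identity (gcd-GCD a b)
  ... | Bézout.+- k l eq = ^≡1-combination b a (gcd a b) l k xᵇ≡1 xᵃ≡1
                             (trans (cong (gcd a b ℕ.+_) (ℕ.*-comm b l)) (trans eq (ℕ.*-comm k a)))
  ... | Bézout.-+ k l eq = ^≡1-combination a b (gcd a b) k l xᵃ≡1 xᵇ≡1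
                             (trans (cong (gcd a b ℕ.+_) (ℕ.*-comm a k)) (trans eq (ℕ.*-comm l b)))

  *-cancelˡ-mod-prime : ∀ {p} → Prime p → ∀ z → ¬ p ℕ.∣ ∣ z ∣ →
                        z * x ≡ z * y mod + p → x ≡ y mod + p
  *-cancelˡ-mod-prime {x} {y} {p} pp z p∤z (congruent p∣zx-zy)
    with euclidsLemma ∣ z ∣ ∣ x - y ∣ pp (subst (p ℕ.∣_) (abs-* z (x - y)) (∣⇒∣ᵤ p∣z[x-y]))
    where p∣z[x-y] = subst (+ p ∣_) (lemma z x y) p∣zx-zy
            where lemma : ∀ z x y → z * x - z * y ≡ z * (x - y)
                  lemma = solve-∀
  ... | inj₁ p∣z   = contradiction p∣z p∤z
  ... | inj₂ p∣x-y = congruent (∣ᵤ⇒∣ p∣x-y)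


module Divisibility where

  open import Data.Nat
  open import Data.Nat.Properties
  open import Data.Nat.Divisibility
  open import Data.Nat.Coprimality using (Coprime; coprime⇒gcd≡1)
  open import Data.Nat.LCM using (lcm; lcm-least; gcd*lcm)
  open import Data.Nat.Induction using (<-rec)
  open import Data.Nat.DivMod using (_/_; m*n/n≡m)
  open import Data.Nat.ListAction using (product)
  open import Data.Nat.Primality
  open import Data.Nat.Primality.Factorisation using (factorise)
  open import Data.List using ([]; _∷_)
  open import Data.List.Relation.Unary.All using (_∷_)
  open import Data.Product using (∃-syntax; _×_; _,_)
  open import Data.Sum using (inj₁; inj₂)
  open import Relation.Nullary using (¬_; contradiction; yes; no)
  open import Relation.Binary.PropositionalEquality
  open import Function using (_∘_)

  prime≥2 : ∀ {p} → Prime p → 2 ≤ p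
  prime≥2 {p} pp = nonTrivial⇒n>1 p {{prime⇒nonTrivial pp}}

  prime∤1 : ∀ {p} → Prime p → ¬ p ∣ 1
  prime∤1 pp p∣1 = <⇒≱ (prime≥2 pp) (∣⇒≤ p∣1)

  prime∤! : ∀ {p m} → Prime p → m < p → ¬ p ∣ m !
  prime∤! {m = zero}  pp _   = prime∤1 pp
  prime∤! {m = suc m} pp m<p p∣m! with euclidsLemma (suc m) (m !) pp p∣m!
  ... | inj₁ p∣1+m = <⇒≱ m<p (∣⇒≤ p∣1+m)
  ... | inj₂ p∣m!  = prime∤! pp (<-trans (n<1+n m) m<p) p∣m!

  prime∣prime⇒≡ : ∀ {q p} → Prime q → Prime p → q ∣ p → q ≡ p
  prime∣prime⇒≡ pq pp q∣p with prime⇒irreducible pp q∣p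
  ... | inj₁ refl = contradiction ∣-refl (prime∤1 pq)
  ... | inj₂ q≡p  = q≡p

  prime∣^⇒prime∣ : ∀ {p m} e → Prime p → p ∣ m ^ e → p ∣ m
  prime∣^⇒prime∣ zero    pp p∣1 = contradiction p∣1 (prime∤1 pp)
  prime∣^⇒prime∣ {m = m} (suc e) pp p∣m^e with euclidsLemma m (m ^ e) pp p∣m^e
  ... | inj₁ p∣m   = p∣m
  ... | inj₂ p∣m^e = prime∣^⇒prime∣ e pp p∣m^e

  ∃-prime-divisor : ∀ {n} → 2 ≤ n → ∃[ q ] Prime q × q ∣ n
  ∃-prime-divisor {n} 2≤n with factorise n {{>-nonZero (<⇒≤ 2≤n)}}
  ... | record { factors = [] ; isFactorisation = n≡1 } = contradiction n≡1 (>⇒≢ 2≤n)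
  ... | record { factors = q ∷ qs ; isFactorisation = n≡q*qs ; factorsPrime = pq ∷ _ } =
    q , pq , divides (product qs) (trans n≡q*qs (*-comm q (product qs)))

  coprime-by-primes : ∀ {m n} → (∀ {r} → Prime r → r ∣ m → ¬ r ∣ n) → Coprime m n
  coprime-by-primes {m} {n} no-common {0}           (0∣m , 0∣n) rewrite 0∣⇒≡0 0∣m | 0∣⇒≡0 0∣n =
    contradiction (2 ∣0) (no-common prime[2] (2 ∣0))
  coprime-by-primes no-common {1}           _           = refl
  coprime-by-primes no-common {d@(suc (suc _))} (d∣m , d∣n) with ∃-prime-divisor {d} (s≤s (s≤s z≤n))
  ... | r , pr , r∣d = contradiction (∣-trans r∣d d∣n) (no-common pr (∣-trans r∣d d∣m))

  coprime-prime^ : ∀ {q m} e → Prime q → ¬ q ∣ m → Coprime (q ^ e) m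
  coprime-prime^ e pq q∤m = coprime-by-primes λ pr r∣q^e r∣m →
    q∤m (subst (_∣ _) (prime∣prime⇒≡ pr pq (prime∣^⇒prime∣ e pr r∣q^e)) r∣m)

  coprime-*-∣ : ∀ {a b n} → Coprime a b → a ∣ n → b ∣ n → a * b ∣ n
  coprime-*-∣ {a} {b} coprime a∣n b∣n = subst (_∣ _) lcm≡a*b (lcm-least a∣n b∣n)
    where
    lcm≡a*b : lcm a b ≡ a * b
    lcm≡a*b = trans (sym (*-identityˡ (lcm a b)))
                    (trans (cong (_* lcm a b) (sym (coprime⇒gcd≡1 coprime))) (gcd*lcm a b))

  odd⇒≡1+2* : ∀ {n} → ¬ 2 ∣ n → ∃[ u ] n ≡ suc (2 * u)
  odd⇒≡1+2* {zero}        2∤n = contradiction (2 ∣0) 2∤n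
  odd⇒≡1+2* {suc zero}    2∤n = 0 , refl
  odd⇒≡1+2* {suc (suc n)} 2∤n with odd⇒≡1+2* {n} (2∤n ∘ ∣m∣n⇒∣m+n (∣-refl {2}))
  ... | u , refl = suc u , cong (λ n → suc (suc n)) (sym (+-suc u (u + 0)))

  1+2*-odd : ∀ u → ¬ 2 ∣ suc (2 * u)
  1+2*-odd u 2∣1+2u =
    prime∤1 prime[2] (∣m+n∣m⇒∣n (subst (2 ∣_) (+-comm 1 (2 * u)) 2∣1+2u) (m∣m*n u))

  [p∸1]/2≡m : ∀ {p m} → p ≡ suc (2 * m) → (p ∸ 1) / 2 ≡ m
  [p∸1]/2≡m {m = m} refl = trans (cong (_/ 2) (*-comm 2 m)) (m*n/n≡m m 2)

  factor-prime-power : ∀ {q} → Prime q → ∀ n → 1 ≤ n → ∃[ e ] ∃[ m ] n ≡ q ^ e * m × ¬ q ∣ m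
  factor-prime-power {q} pq = <-rec _ step
    where
    step : ∀ n → (∀ {k} → k < n → 1 ≤ k → ∃[ e ] ∃[ m ] k ≡ q ^ e * m × ¬ q ∣ m) →
           1 ≤ n → ∃[ e ] ∃[ m ] n ≡ q ^ e * m × ¬ q ∣ m
    step n rec 1≤n with q ∣? n
    ... | no q∤n  = 0 , n , sym (+-identityʳ n) , q∤n
    ... | yes q∣n with rec (quotient-< q∣n) (>-nonZero⁻¹ (quotient q∣n) {{quotient≢0 q∣n}})
      where instance _ = prime⇒nonTrivial pq
                     _ = >-nonZero 1≤n
    ...   | e , m , k≡q^e*m , q∤m = suc e , m , n≡q^[1+e]*m , q∤m
      where
      n≡q^[1+e]*m = trans (m∣n⇒n≡m*quotient q∣n) (trans (cong (q *_) k≡q^e*m) (sym (*-assoc q (q ^ e) m)))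

  ∣-by-prime-powers : ∀ {X} n → 1 ≤ n → (∀ {q} e → Prime q → q ^ e ∣ n → q ^ e ∣ X) → n ∣ X
  ∣-by-prime-powers {X} = <-rec _ step
    where
    Powers∣X : ℕ → Set
    Powers∣X n = ∀ {q} e → Prime q → q ^ e ∣ n → q ^ e ∣ X
    step : ∀ n → (∀ {k} → k < n → 1 ≤ k → Powers∣X k → k ∣ X) →
           1 ≤ n → Powers∣X n → n ∣ X
    step 1                rec _ _ = 1∣ X
    step n@(suc (suc _))  rec _ powers∣X with ∃-prime-divisor {n} (s≤s (s≤s z≤n))
    ... | q , pq , q∣n with factor-prime-power pq n (s≤s z≤n)
    ...   | zero  , m , n≡m   , q∤m = contradiction (subst (q ∣_) (trans n≡m (+-identityʳ m)) q∣n) q∤m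
    ...   | suc e , m , n≡q^e*m , q∤m =
      subst (_∣ X) (sym n≡q^e*m)
        (coprime-*-∣ (coprime-prime^ (suc e) pq q∤m) (powers∣X (suc e) pq q^e∣n) m∣X)
      where
      q^e∣n : q ^ suc e ∣ n
      q^e∣n = divides m (trans n≡q^e*m (*-comm (q ^ suc e) m))
      m∣n : m ∣ n
      m∣n = divides (q ^ suc e) n≡q^e*m
      1≤m : 1 ≤ m
      1≤m = >-nonZero⁻¹ m {{quotient≢0 q^e∣n}}
      1<q^[1+e] : 1 < q ^ suc e
      1<q^[1+e] = <-≤-trans (prime≥2 pq) (m≤m*n q (q ^ e) {{m^n≢0 q e {{prime⇒nonZero pq}}}})
      m<n : m < n
      m<n = subst (m <_) (trans (*-comm m (q ^ suc e)) (sym n≡q^e*m))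
                  (m<m*n m (q ^ suc e) {{>-nonZero 1≤m}} 1<q^[1+e])
      m∣X : m ∣ X
      m∣X = rec m<n 1≤m (λ e′ pr r^e′∣m → powers∣X e′ pr (∣-trans r^e′∣m m∣n))


module Fermat where

  open import Data.Nat
  open import Data.Nat.Properties
  open import Data.Nat.Divisibility
  open import Data.Nat.DivMod using (m/n*n≡m)
  open import Data.Nat.Primality using (Prime; euclidsLemma)
  open import Data.Nat.Combinatorics using (_C_; nCn≡1; nCk≡n!/k![n-k]!; k![n∸k]!∣n!)
  open import Data.Fin using (Fin; zero; suc; toℕ; inject₁; fromℕ)
  open import Data.Fin.Properties using (toℕ-inject₁; toℕ-fromℕ; toℕ<n)
  open import Data.Vec.Functional using (init; tail)
  open import Data.Sum using (inj₁; inj₂)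
  open import Data.Product using (∃-syntax; _×_; _,_)
  open import Data.Integer as ℤ using (ℤ; +_; 1ℤ)
  import Data.Integer.Properties as ℤ
  open import Data.Integer.Divisibility.Signed using (∣ᵤ⇒∣)
  open import Relation.Nullary using (¬_; contradiction)
  open import Relation.Binary.PropositionalEquality
  open import Algebra.Definitions.RawSemiring +-*-rawSemiring using () renaming (_^_ to _^′_; _×_ to _×′_)
  open import Algebra.Properties.Monoid.Sum +-0-monoid using (sum; sum-init-last; sum-cong-≗)
  import Algebra.Properties.CommutativeSemiring.Binomial +-*-commutativeSemiring as Binomial
  open Congruence
  open Divisibility using (prime≥2; prime∤1; prime∤!)

  -- The library's binomial theorem is stated with the generic semiring multiples and powers.
  ×′≡* : ∀ n x → n ×′ x ≡ n * x
  ×′≡* zero    x = refl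
  ×′≡* (suc n) x = cong (λ y → x + y) (×′≡* n x)

  ^′≡^ : ∀ x n → x ^′ n ≡ x ^ n
  ^′≡^ x zero    = refl
  ^′≡^ x (suc n) = cong (x *_) (^′≡^ x n)

  binomial-theorem : ∀ n x → (x + 1) ^ n ≡ sum (λ (k : Fin (suc n)) → (n C toℕ k) * x ^ toℕ k)
  binomial-theorem n x = begin
    (x + 1) ^ n                      ≡⟨ ^′≡^ (x + 1) n ⟨
    (x + 1) ^′ n                     ≡⟨ Binomial.theorem n x 1 ⟩
    Binomial.binomialExpansion x 1 n ≡⟨ sum-cong-≗ {suc n} term ⟩
    sum (λ (k : Fin (suc n)) → (n C toℕ k) * x ^ toℕ k) ∎
    where
    open ≡-Reasoning
    term : ∀ (k : Fin (suc n)) → Binomial.binomialTerm x 1 n k ≡ (n C toℕ k) * x ^ toℕ k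
    term k = begin
      (n C i) ×′ (x ^′ i * 1 ^′ (n ∸ i)) ≡⟨ ×′≡* (n C i) _ ⟩
      (n C i) * (x ^′ i * 1 ^′ (n ∸ i))  ≡⟨ cong₂ (λ a b → (n C i) * (a * b)) (^′≡^ x i) 1^′≡1 ⟩
      (n C i) * (x ^ i * 1)              ≡⟨ cong (λ z → (n C i) * z) (*-identityʳ (x ^ i)) ⟩
      (n C i) * x ^ i                    ∎
      where
      i = toℕ k
      1^′≡1 = trans (^′≡^ 1 (n ∸ i)) (^-zeroˡ (n ∸ i))

  ∣-sum : ∀ {d n} (f : Fin n → ℕ) → (∀ i → d ∣ f i) → d ∣ sum f
  ∣-sum {n = zero}  f d∣f = _ ∣0
  ∣-sum {n = suc n} f d∣f = ∣m∣n⇒∣m+n (d∣f zero) (∣-sum (tail f) (λ i → d∣f (suc i)))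

  C*k!*[n∸k]!≡n! : ∀ {n k} → k ≤ n → (n C k) * (k ! * (n ∸ k) !) ≡ n !
  C*k!*[n∸k]!≡n! {n} {k} k≤n = trans (cong (_* (k ! * (n ∸ k) !)) (nCk≡n!/k![n-k]! k≤n))
                                     (m/n*n≡m {{k !* (n ∸ k) !≢0}} (k![n∸k]!∣n! k≤n))

  prime∣C : ∀ {p k} → Prime p → 0 < k → k < p → p ∣ p C k
  prime∣C {p@(suc r)} {k} pp 0<k k<p with euclidsLemma (p C k) (k ! * (p ∸ k) !) pp p∣C*k!*[p∸k]!
    where p∣C*k!*[p∸k]! = subst (p ∣_) (sym (C*k!*[n∸k]!≡n! (<⇒≤ k<p))) (m∣m*n (r !))
  ... | inj₁ p∣C = p∣C
  ... | inj₂ p∣k!*[p∸k]! with euclidsLemma (k !) ((p ∸ k) !) pp p∣k!*[p∸k]!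
  ...   | inj₁ p∣k!     = contradiction p∣k! (prime∤! pp k<p)
  ...   | inj₂ p∣[p∸k]! = contradiction p∣[p∸k]! (prime∤! pp (∸-monoʳ-< 0<k (<⇒≤ k<p)))

  binomial-mod-prime : ∀ {p} → Prime p → ∀ x → ∃[ M ] p ∣ M × (x + 1) ^ p ≡ 1 + (M + x ^ p)
  binomial-mod-prime {p} pp x with prime≥2 pp
  binomial-mod-prime {p@(suc (suc r))} pp x | s≤s (s≤s _) = sum middle , ∣-sum middle p∣middle , expansion
    where
    t : Fin (suc p) → ℕ
    t k = (p C toℕ k) * x ^ toℕ k
    middle : Fin (suc r) → ℕ
    middle = init (tail t)
    p∣middle : ∀ i → p ∣ middle i
    p∣middle i = ∣m⇒∣m*n (x ^ suc (toℕ (inject₁ i)))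
                   (prime∣C pp z<s (s≤s (subst (_< suc r) (sym (toℕ-inject₁ i)) (toℕ<n i))))
    last≡x^p : t (suc (fromℕ (suc r))) ≡ x ^ p
    last≡x^p rewrite toℕ-fromℕ r = trans (cong (_* x ^ p) (nCn≡1 p)) (*-identityˡ (x ^ p))
    expansion : (x + 1) ^ p ≡ 1 + (sum middle + x ^ p)
    expansion = begin
      (x + 1) ^ p                                    ≡⟨ binomial-theorem p x ⟩
      t zero + sum (tail t)                          ≡⟨ cong (λ y → t zero + y) (sum-init-last (tail t)) ⟩
      1 + (sum middle + t (suc (fromℕ (suc r))))     ≡⟨ cong (λ y → 1 + (sum middle + y)) last≡x^p ⟩
      1 + (sum middle + x ^ p)                       ∎
      where open ≡-Reasoning

  fermat : ∀ {p} → Prime p → ∀ x → + (x ^ p) ≡ + x mod + p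
  fermat pp zero with prime≥2 pp
  ... | s≤s _ = ≡mod-refl
  fermat {p} pp (suc x) with binomial-mod-prime pp x
  ... | M , p∣M , expansion = begin
    + (suc x ^ p)                  ≡⟨ cong (λ y → + (y ^ p)) (+-comm 1 x) ⟩
    + ((x + 1) ^ p)                ≡⟨ cong +_ expansion ⟩
    + (1 + (M + x ^ p))            ≡⟨ cong (λ y → 1ℤ ℤ.+ y) (ℤ.pos-+ M (x ^ p)) ⟩
    1ℤ ℤ.+ (+ M ℤ.+ + (x ^ p))     ≈⟨ +-cong-mod (≡mod-refl {1ℤ}) (+-cong-mod M≡0 (fermat pp x)) ⟩
    + suc x                        ∎
    where
    open ≡mod-Reasoning (+ p)
    M≡0 = ∣⇒≡0[mod] (∣ᵤ⇒∣ {+ p} {+ M} p∣M)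

  fermat-little : ∀ {p} → Prime p → ∀ {x} → ¬ p ∣ x → (+ x) ℤ.^ (p ∸ 1) ≡ 1ℤ mod + p
  fermat-little {p} pp p∤x with prime≥2 pp
  fermat-little {suc p} pp {x} p∤x | s≤s _ = *-cancelˡ-mod-prime pp (+ x) p∤x (begin
    + x ℤ.* (+ x) ℤ.^ p     ≡⟨ pos-^ x (suc p) ⟨
    + (x ^ suc p)           ≈⟨ fermat pp x ⟩
    + x                     ≡⟨ ℤ.*-identityʳ (+ x) ⟨
    + x ℤ.* 1ℤ              ∎)
    where open ≡mod-Reasoning (+ suc p)


module UnitsModPrime where

  open import Data.Nat as ℕ using (ℕ; zero; suc; s≤s; z≤n; _≤_; _<_)
  import Data.Nat.Properties as ℕ
  import Data.Nat.Divisibility as ℕ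
  open import Data.Nat.GCD using (gcd; gcd[m,n]∣m; gcd[m,n]∣n; gcd[m,n]≡0⇒n≡0)
  open import Data.Nat.Primality using (Prime)
  open import Data.Integer hiding (suc; pred; _≤_; _<_)
  open import Data.Integer.Properties
  open import Data.Integer.Divisibility.Signed using (∣⇒∣ᵤ)
  open import Data.Integer.Tactic.RingSolver using (solve-∀)
  open import Data.List using (List; []; _∷_; length)
  open import Data.Sum using (inj₁; inj₂)
  open import Relation.Nullary using (¬_; contradiction)
  open import Function using (case_of_)
  open import Relation.Binary.PropositionalEquality
  open Congruence
  open Divisibility using (prime≥2)
  open Fermat using (fermat-little)

  eval : List ℤ → ℤ → ℤ
  eval []       x = 0ℤ
  eval (c ∷ cs) x = c + x * eval cs x

  -- Synthetic division: the quotient of f by X - a.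
  divide : ℤ → List ℤ → List ℤ
  divide a []           = []
  divide a (c ∷ [])     = []
  divide a (c ∷ d ∷ ds) = eval (d ∷ ds) a ∷ divide a (d ∷ ds)

  eval-divide : ∀ a f x → eval f x ≡ (x - a) * eval (divide a f) x + eval f a
  eval-divide a []           x = lemma x a
    where lemma : ∀ x a → 0ℤ ≡ (x - a) * 0ℤ + 0ℤ
          lemma = solve-∀
  eval-divide a (c ∷ [])     x = lemma c x a
    where lemma : ∀ c x a → c + x * 0ℤ ≡ (x - a) * 0ℤ + (c + a * 0ℤ)
          lemma = solve-∀
  eval-divide a (c ∷ d ∷ ds) x = begin
    c + x * eval g x                                ≡⟨ cong (λ y → c + x * y) (eval-divide a (d ∷ ds) x) ⟩
    c + x * ((x - a) * eval q x + eval g a)         ≡⟨ lemma c x a (eval q x) (eval g a) ⟩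
    (x - a) * (eval g a + x * eval q x) + (c + a * eval g a) ∎
    where
    open ≡-Reasoning
    g = d ∷ ds
    q = divide a g
    lemma : ∀ c x a q g → c + x * ((x - a) * q + g) ≡ (x - a) * (g + x * q) + (c + a * g)
    lemma = solve-∀

  length-divide : ∀ a c cs → length (divide a (c ∷ cs)) ≡ length cs
  length-divide a c []       = refl
  length-divide a c (d ∷ ds) = cong suc (length-divide a d ds)

  prime∤∣i-j∣ : ∀ {p i j} → Prime p → i < j → j < p → ¬ p ℕ.∣ ∣ + i - + j ∣
  prime∤∣i-j∣ {p} {i} {j} pp i<j j<p p∣ =
    ℕ.<⇒≱ (ℕ.≤-<-trans (ℕ.m∸n≤m j i) j<p) (ℕ.∣⇒≤ p∣j∸i)
    where
    instance _ = ℕ.>-nonZero (ℕ.m<n⇒0<n∸m i<j)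
    p∣j∸i : p ℕ.∣ j ℕ.∸ i
    p∣j∸i = subst (p ℕ.∣_) (trans (cong ∣_∣ (m-n≡m⊖n i j)) (∣⊖∣-< i<j)) p∣

  vanishes-on-[1,k]⇒vanishes : ∀ {p} → Prime p → ∀ k f → length f ≤ k → k < p →
    (∀ j → 1 ≤ j → j ≤ k → eval f (+ j) ≡ 0ℤ mod + p) → ∀ x → eval f x ≡ 0ℤ mod + p
  vanishes-on-[1,k]⇒vanishes pp k       []       _         _   _      x = ≡mod-refl
  vanishes-on-[1,k]⇒vanishes {p} pp (suc k) (c ∷ cs) (s≤s len) k<p vanish x = begin
    eval f x                         ≡⟨ eval-divide r f x ⟩
    (x - r) * eval q x + eval f r    ≈⟨ +-cong-mod (*-cong-mod (≡mod-refl {x - r}) (q-vanishing x)) f[r]≡0 ⟩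
    (x - r) * 0ℤ + 0ℤ                ≡⟨ lemma (x - r) ⟩
    0ℤ                               ∎
    where
    open ≡mod-Reasoning (+ p)
    f = c ∷ cs
    r = + suc k
    q = divide r f
    f[r]≡0 = vanish (suc k) (s≤s z≤n) ℕ.≤-refl
    lemma : ∀ y → y * 0ℤ + 0ℤ ≡ 0ℤ
    lemma = solve-∀
    q-vanishing-at : ∀ j → 1 ≤ j → j ≤ k → eval q (+ j) ≡ 0ℤ mod + p
    q-vanishing-at j 1≤j j≤k = *-cancelˡ-mod-prime pp (+ j - r) (prime∤∣i-j∣ pp (s≤s j≤k) k<p) (begin
      (+ j - r) * eval q (+ j)                       ≡⟨ lemma′ (+ j - r) (eval q (+ j)) (eval f r) ⟨
      (+ j - r) * eval q (+ j) + eval f r - eval f r ≡⟨ cong (_- eval f r) (eval-divide r f (+ j)) ⟨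
      eval f (+ j) - eval f r                        ≈⟨ +-cong-mod f[j]≡0 (neg-cong-mod f[r]≡0) ⟩
      0ℤ - 0ℤ                                        ≡⟨ lemma″ (+ j - r) ⟩
      (+ j - r) * 0ℤ                                 ∎)
      where
      f[j]≡0 = vanish j 1≤j (ℕ.m≤n⇒m≤1+n j≤k)
      lemma′ : ∀ y e g → y * e + g - g ≡ y * e
      lemma′ = solve-∀
      lemma″ : ∀ y → 0ℤ - 0ℤ ≡ y * 0ℤ
      lemma″ = solve-∀
    q-vanishing : ∀ y → eval q y ≡ 0ℤ mod + p
    q-vanishing = vanishes-on-[1,k]⇒vanishes pp k q (subst (_≤ k) (sym (length-divide r c cs)) len)
                    (ℕ.<-trans (ℕ.n<1+n k) k<p) q-vanishing-at

  monomial : ℕ → List ℤ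
  monomial zero    = 1ℤ ∷ []
  monomial (suc d) = 0ℤ ∷ monomial d

  eval-monomial : ∀ d x → eval (monomial d) x ≡ x ^ d
  eval-monomial zero    x = trans (cong (λ y → 1ℤ + y) (*-zeroʳ x)) (+-identityʳ 1ℤ)
  eval-monomial (suc d) x = trans (+-identityˡ _) (cong (x *_) (eval-monomial d x))

  length-monomial : ∀ d → length (monomial d) ≡ suc d
  length-monomial zero    = refl
  length-monomial (suc d) = cong suc (length-monomial d)

  -- X^e − 1 has at most e roots, and 1, …, e + 1 are distinct nonzero residues.
  units-pow≢1 : ∀ {p} → Prime p → ∀ e → 1 ≤ e → suc e < p →
                ¬ (∀ a → ¬ p ℕ.∣ a → (+ a) ^ e ≡ 1ℤ mod + p)
  units-pow≢1 {p} pp (suc d) _ 1+e<p all≡1 = ℕ.<⇒≱ (prime≥2 pp) (ℕ.∣⇒≤ p∣1)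
    where
    f = -1ℤ ∷ monomial d
    eval-f : ∀ x → eval f x ≡ x ^ suc d - 1ℤ
    eval-f x = trans (cong (λ y → -1ℤ + x * y) (eval-monomial d x)) (+-comm -1ℤ (x ^ suc d))
    roots : ∀ j → 1 ≤ j → j ≤ suc (suc d) → eval f (+ j) ≡ 0ℤ mod + p
    roots j 1≤j j≤e+1 = begin
      eval f (+ j)            ≡⟨ eval-f (+ j) ⟩
      (+ j) ^ suc d - 1ℤ      ≈⟨ +-cong-mod (all≡1 j p∤j) ≡mod-refl ⟩
      1ℤ - 1ℤ                 ∎
      where
      open ≡mod-Reasoning (+ p)
      p∤j : ¬ p ℕ.∣ j
      p∤j p∣j = ℕ.<⇒≱ (ℕ.≤-<-trans j≤e+1 1+e<p) (ℕ.∣⇒≤ {{ℕ.>-nonZero 1≤j}} p∣j)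
    f≡0 : eval f 0ℤ ≡ 0ℤ mod + p
    f≡0 = vanishes-on-[1,k]⇒vanishes pp (suc (suc d)) f
            (ℕ.≤-reflexive (cong suc (length-monomial d))) 1+e<p roots 0ℤ
    p∣1 : p ℕ.∣ 1
    p∣1 = ∣⇒∣ᵤ (≡0[mod]⇒∣ f≡0)

  units-pow≡1⇒p∸1∣ : ∀ {p} → Prime p → ∀ c →
                     (∀ a → ¬ p ℕ.∣ a → (+ a) ^ c ≡ 1ℤ mod + p) → p ℕ.∸ 1 ℕ.∣ c
  units-pow≡1⇒p∸1∣ {p} pp c all≡1 = case ℕ.m≤n⇒m<n∨m≡n g≤p∸1 of λ where
      (inj₁ g<p∸1) → contradiction all-g≡1 (units-pow≢1 pp g 1≤g (ℕ.≤-trans (s≤s g<p∸1) 1+[p∸1]≤p))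
      (inj₂ g≡p∸1) → subst (ℕ._∣ c) g≡p∸1 (gcd[m,n]∣m c (p ℕ.∸ 1))
    where
    g = gcd c (p ℕ.∸ 1)
    1+[p∸1]≤p : suc (p ℕ.∸ 1) ≤ p
    1+[p∸1]≤p = ℕ.≤-reflexive (ℕ.m+[n∸m]≡n (ℕ.<⇒≤ (prime≥2 pp)))
    0<p∸1 : 0 < p ℕ.∸ 1
    0<p∸1 = ℕ.m<n⇒0<n∸m (prime≥2 pp)
    g≤p∸1 : g ≤ p ℕ.∸ 1
    g≤p∸1 = ℕ.∣⇒≤ {{ℕ.>-nonZero 0<p∸1}} (gcd[m,n]∣n c (p ℕ.∸ 1))
    1≤g : 1 ≤ g
    1≤g = ℕ.n≢0⇒n>0 (λ g≡0 → ℕ.n>0⇒n≢0 0<p∸1 (gcd[m,n]≡0⇒n≡0 c g≡0))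
    all-g≡1 : ∀ a → ¬ p ℕ.∣ a → (+ a) ^ g ≡ 1ℤ mod + p
    all-g≡1 a p∤a = ^≡1⇒^gcd≡1 c (p ℕ.∸ 1) (all≡1 a p∤a) (fermat-little pp p∤a)


module QuadraticCharacterOfTwo where

  module _ where

    open import Data.Nat
    open import Data.Nat.Properties
    open import Data.Nat.Tactic.RingSolver using (solve-∀)
    open import Relation.Binary.PropositionalEquality
    open ≡-Reasoning

    evens : ℕ → ℕ
    evens zero    = 1
    evens (suc n) = evens n * (2 * suc n)

    odds : ℕ → ℕ
    odds zero    = 1
    odds (suc n) = odds n * suc (2 * n)

    topEvens : ℕ → ℕ → ℕ
    topEvens n zero    = 1
    topEvens n (suc j) = topEvens n j * (2 * (n ∸ j))

    evens≡2^n*n! : ∀ n → evens n ≡ 2 ^ n * n !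
    evens≡2^n*n! zero    = refl
    evens≡2^n*n! (suc n) = trans (cong (_* (2 * suc n)) (evens≡2^n*n! n)) (lemma (2 ^ n) (n !) n)
      where lemma : ∀ a b n → a * b * (2 * suc n) ≡ 2 * a * (suc n * b)
            lemma = solve-∀

    [1+2h]!≡evens*odds : ∀ h → suc (2 * h) ! ≡ evens h * odds (suc h)
    [1+2h]!≡evens*odds zero    = refl
    [1+2h]!≡evens*odds (suc h) = begin
      suc (2 * suc h) !                                      ≡⟨ cong (λ n → suc n !) (*-suc 2 h) ⟩
      (3 + 2 * h) * ((2 + 2 * h) * suc (2 * h) !)            ≡⟨ cong (λ n → (3 + 2 * h) * ((2 + 2 * h) * n))
                                                                     ([1+2h]!≡evens*odds h) ⟩
      (3 + 2 * h) * ((2 + 2 * h) * (evens h * odds (suc h))) ≡⟨ lemma (evens h) (odds (suc h)) h ⟩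
      evens (suc h) * odds (suc (suc h))                     ∎
      where
      lemma : ∀ e o h → (3 + 2 * h) * ((2 + 2 * h) * (e * o)) ≡ e * (2 * suc h) * (o * suc (2 * suc h))
      lemma = solve-∀

    evens-split : ∀ a j → evens (a + j) ≡ evens a * topEvens (a + j) j
    evens-split a zero    = trans (cong evens (+-identityʳ a)) (sym (*-identityʳ (evens a)))
    evens-split a (suc j) = begin
      evens (a + suc j)                              ≡⟨ cong evens (+-suc a j) ⟩
      evens (suc a + j)                              ≡⟨ evens-split (suc a) j ⟩
      evens a * (2 * suc a) * T                      ≡⟨ lemma (evens a) (2 * suc a) T ⟩
      evens a * (T * (2 * suc a))                    ≡⟨ cong (λ n → evens a * (T * (2 * n))) (m+n∸n≡m (suc a) j) ⟨
      evens a * topEvens (suc a + j) (suc j)         ≡⟨ cong (λ n → evens a * topEvens n (suc j)) (+-suc a j) ⟨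
      evens a * topEvens (a + suc j) (suc j)         ∎
      where
      T = topEvens (suc a + j) j
      lemma : ∀ x y z → x * y * z ≡ x * (z * y)
      lemma = solve-∀

    2[n∸j]+[1+2j]≡1+2n : ∀ {n j} → j ≤ n → 2 * (n ∸ j) + suc (2 * j) ≡ suc (2 * n)
    2[n∸j]+[1+2j]≡1+2n {n} {j} j≤n = begin
      2 * (n ∸ j) + suc (2 * j)  ≡⟨ +-suc _ _ ⟩
      suc (2 * (n ∸ j) + 2 * j)  ≡⟨ cong suc (*-distribˡ-+ 2 (n ∸ j) j) ⟨
      suc (2 * (n ∸ j + j))      ≡⟨ cong (λ m → suc (2 * m)) (m∸n+n≡m j≤n) ⟩
      suc (2 * n)                ∎

  open import Data.Nat as ℕ using (ℕ; zero; suc; s≤s; _≤_; _<_; _!)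
  import Data.Nat.Properties as ℕ
  import Data.Nat.Divisibility as ℕ
  open import Data.Nat.Primality using (Prime)
  open import Data.Integer hiding (suc; pred; _≤_; _<_)
  open import Data.Integer.Properties
  open import Data.Integer.Tactic.RingSolver using (solve-∀)
  open import Relation.Binary.PropositionalEquality
  open import Relation.Nullary using (¬_)
  open Congruence
  open Divisibility using (prime∤!)

  topEvens≡±odds : ∀ {p} n → p ≡ suc (2 ℕ.* n) → ∀ j → j ≤ n →
                   + topEvens n j ≡ -1ℤ ^ j * + odds j mod + p
  topEvens≡±odds n p≡1+2n zero    _   = ≡mod-refl
  topEvens≡±odds {p} n p≡1+2n (suc j) j<n = begin
    + (topEvens n j ℕ.* (2 ℕ.* (n ℕ.∸ j)))        ≡⟨ pos-* (topEvens n j) _ ⟩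
    + topEvens n j * + (2 ℕ.* (n ℕ.∸ j))          ≈⟨ *-cong-mod previous factor ⟩
    -1ℤ ^ j * + odds j * - + suc (2 ℕ.* j)        ≡⟨ lemma (-1ℤ ^ j) (+ odds j) (+ suc (2 ℕ.* j)) ⟩
    -1ℤ * -1ℤ ^ j * (+ odds j * + suc (2 ℕ.* j))  ≡⟨ cong (-1ℤ * -1ℤ ^ j *_) (pos-* (odds j) _) ⟨
    -1ℤ ^ suc j * + odds (suc j)                  ∎
    where
    open ≡mod-Reasoning (+ p)
    lemma : ∀ s o q → s * o * - q ≡ -1ℤ * s * (o * q)
    lemma = solve-∀
    previous = topEvens≡±odds n p≡1+2n j (ℕ.<⇒≤ j<n)
    factor : + (2 ℕ.* (n ℕ.∸ j)) ≡ - + suc (2 ℕ.* j) mod + p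
    factor = complement-mod (trans (2[n∸j]+[1+2j]≡1+2n (ℕ.<⇒≤ j<n)) (sym p≡1+2n))

  -- 2^m m! = (2·4⋯2h)·(2m·(2m−2)⋯(2h+2)), and 2(m − j) ≡ −(2j + 1) turns the second
  -- factor into (−1)^(h+1)·1·3⋯(2h+1); the two together are (−1)^(h+1) m!.
  2^half≡±1 : ∀ {p m h} → Prime p → p ≡ suc (2 ℕ.* m) → m ≡ suc (2 ℕ.* h) →
              (+ 2) ^ m ≡ -1ℤ ^ suc h mod + p
  2^half≡±1 {p} {m} {h} pp p≡1+2m refl = *-cancelˡ-mod-prime pp (+ (m !)) p∤m! (begin
    + (m !) * (+ 2) ^ m                          ≡⟨ *-comm (+ (m !)) _ ⟩
    (+ 2) ^ m * + (m !)                          ≡⟨ cong (_* + (m !)) (pos-^ 2 m) ⟨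
    + (2 ℕ.^ m) * + (m !)                        ≡⟨ pos-* (2 ℕ.^ m) (m !) ⟨
    + (2 ℕ.^ m ℕ.* m !)                          ≡⟨ cong +_ (evens≡2^n*n! m) ⟨
    + evens m                                    ≡⟨ cong +_ evens-m ⟩
    + (evens h ℕ.* topEvens m (suc h))           ≡⟨ pos-* (evens h) _ ⟩
    + evens h * + topEvens m (suc h)             ≈⟨ *-cong-mod (≡mod-refl {+ evens h}) top≡±odds ⟩
    + evens h * (-1ℤ ^ suc h * + odds (suc h))   ≡⟨ lemma (+ evens h) (-1ℤ ^ suc h) (+ odds (suc h)) ⟩
    + evens h * + odds (suc h) * -1ℤ ^ suc h     ≡⟨ cong (_* -1ℤ ^ suc h) (pos-* (evens h) _) ⟨
    + (evens h ℕ.* odds (suc h)) * -1ℤ ^ suc h   ≡⟨ cong (λ n → + n * -1ℤ ^ suc h) m!≡evens*odds ⟨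
    + (m !) * -1ℤ ^ suc h                        ∎)
    where
    open ≡mod-Reasoning (+ p)
    lemma : ∀ e s o → e * (s * o) ≡ e * o * s
    lemma = solve-∀
    m!≡evens*odds = [1+2h]!≡evens*odds h
    top≡±odds = topEvens≡±odds m p≡1+2m (suc h) (s≤s (ℕ.m≤m+n h (h ℕ.+ 0)))
    p∤m! : ¬ p ℕ.∣ m !
    p∤m! = prime∤! pp (subst (m <_) (sym p≡1+2m) (s≤s (ℕ.m≤n*m m 2)))
    evens-m : evens m ≡ evens h ℕ.* topEvens m (suc h)
    evens-m = subst (λ n → evens n ≡ evens h ℕ.* topEvens n (suc h))
                    (trans (ℕ.+-suc h h) (cong (λ n → suc (h ℕ.+ n)) (sym (ℕ.+-identityʳ h))))
                    (evens-split h (suc h))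


module Lifting where

  open import Data.Nat as ℕ using (ℕ; zero; suc)
  import Data.Nat.Properties as ℕ
  open import Data.Integer hiding (suc; pred)
  open import Data.Integer.Properties
  open import Data.Integer.Divisibility.Signed
  open import Data.Integer.Tactic.RingSolver using (solve-∀)
  open import Relation.Binary.PropositionalEquality
  open Congruence

  geometric : ℤ → ℕ → ℤ
  geometric x zero    = 0ℤ
  geometric x (suc n) = x ^ n + geometric x n

  x^n-1≡[x-1]*geometric : ∀ x n → x ^ n - 1ℤ ≡ (x - 1ℤ) * geometric x n
  x^n-1≡[x-1]*geometric x zero    = sym (*-zeroʳ (x - 1ℤ))
  x^n-1≡[x-1]*geometric x (suc n) = begin
    x * x ^ n - 1ℤ                              ≡⟨ lemma x (x ^ n) ⟩
    (x - 1ℤ) * x ^ n + (x ^ n - 1ℤ)             ≡⟨ cong (λ y → (x - 1ℤ) * x ^ n + y) previous ⟩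
    (x - 1ℤ) * x ^ n + (x - 1ℤ) * geometric x n ≡⟨ *-distribˡ-+ (x - 1ℤ) (x ^ n) (geometric x n) ⟨
    (x - 1ℤ) * (x ^ n + geometric x n)          ∎
    where
    open ≡-Reasoning
    previous = x^n-1≡[x-1]*geometric x n
    lemma : ∀ x y → x * y - 1ℤ ≡ (x - 1ℤ) * y + (y - 1ℤ)
    lemma = solve-∀

  geometric≡n : ∀ {m x} → x ≡ 1ℤ mod m → ∀ n → geometric x n ≡ + n mod m
  geometric≡n x≡1 zero    = ≡mod-refl
  geometric≡n {m} {x} x≡1 (suc n) = begin
    x ^ n + geometric x n   ≈⟨ +-cong-mod (^-cong-mod n x≡1) (geometric≡n x≡1 n) ⟩
    1ℤ ^ n + + n            ≡⟨ cong (_+ + n) (^-zeroˡ n) ⟩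
    + suc n                 ∎
    where open ≡mod-Reasoning m

  ^-q^e-step : ∀ x q e → (x ^ (q ℕ.^ e)) ^ q ≡ x ^ (q ℕ.^ suc e)
  ^-q^e-step x q e = trans (^-*-assoc x (q ℕ.^ e) q) (cong (x ^_) (ℕ.*-comm (q ℕ.^ e) q))

  neg-^ : ∀ x n → (- x) ^ n ≡ -1ℤ ^ n * x ^ n
  neg-^ x zero    = refl
  neg-^ x (suc n) = trans (cong (- x *_) (neg-^ x n)) (lemma x (-1ℤ ^ n) (x ^ n))
    where lemma : ∀ x s y → - x * (s * y) ≡ -1ℤ * s * (x * y)
          lemma = solve-∀

  -- x^q − 1 = (x − 1)(1 + x + ⋯ + x^(q−1)), and the second factor is ≡ q ≡ 0 modulo q.
  ^q-lift : ∀ q j {x} → x ≡ 1ℤ mod (+ q) ^ suc j → x ^ q ≡ 1ℤ mod (+ q) ^ suc (suc j)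
  ^q-lift q j {x} x≡1@(congruent Q∣x-1) =
    congruent (subst₂ _∣_ (*-comm ((+ q) ^ suc j) (+ q)) (sym (x^n-1≡[x-1]*geometric x q))
      (∣-trans (*-monoˡ-∣ (+ q) Q∣x-1) (*-monoʳ-∣ (x - 1ℤ) q∣geometric)))
    where
    q∣geometric : + q ∣ geometric x q
    q∣geometric = ≡0[mod]⇒∣ (≡mod-trans (geometric≡n x≡1[mod-q] q) (∣⇒≡0[mod] ∣-refl))
      where x≡1[mod-q] = ≡mod-weaken (∣m⇒∣m*n ((+ q) ^ j) ∣-refl) x≡1

  ^q-lift-neg : ∀ {q} j {x t} → q ≡ suc (2 ℕ.* t) →
                x ≡ -1ℤ mod (+ q) ^ suc j → x ^ q ≡ -1ℤ mod (+ q) ^ suc (suc j)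
  ^q-lift-neg {q} j {x} {t} refl x≡-1 = begin
    x ^ q                 ≡⟨ neg-involutive (x ^ q) ⟨
    - - (x ^ q)           ≡⟨ cong -_ (-1*i≡-i (x ^ q)) ⟨
    - (-1ℤ * x ^ q)       ≡⟨ cong (λ s → - (s * x ^ q)) (-1^[1+2k]≡-1 t) ⟨
    - (-1ℤ ^ q * x ^ q)   ≡⟨ cong -_ (neg-^ x q) ⟨
    - ((- x) ^ q)         ≈⟨ neg-cong-mod (^q-lift q j (neg-cong-mod x≡-1)) ⟩
    -1ℤ                   ∎
    where open ≡mod-Reasoning ((+ q) ^ suc (suc j))

  ^q^e-lift : ∀ {q x} → x ≡ 1ℤ mod + q → ∀ e → x ^ (q ℕ.^ e) ≡ 1ℤ mod (+ q) ^ suc e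
  ^q^e-lift {q} {x} x≡1 zero    = subst₂ (_≡ 1ℤ mod_) (sym (^-identityʳ x)) (sym (^-identityʳ (+ q))) x≡1
  ^q^e-lift {q} {x} x≡1 (suc e) = subst (_≡ 1ℤ mod _) (^-q^e-step x q e) (^q-lift q e (^q^e-lift x≡1 e))

  ^q^e-lift-neg : ∀ {q x t} → q ≡ suc (2 ℕ.* t) → x ≡ -1ℤ mod + q →
                  ∀ e → x ^ (q ℕ.^ e) ≡ -1ℤ mod (+ q) ^ suc e
  ^q^e-lift-neg {q} {x} q-odd x≡-1 zero    =
    subst₂ (_≡ -1ℤ mod_) (sym (^-identityʳ x)) (sym (^-identityʳ (+ q))) x≡-1
  ^q^e-lift-neg {q} {x} {t} q-odd x≡-1 (suc e) =
    subst (_≡ -1ℤ mod _) (^-q^e-step x q e) (^q-lift-neg e {t = t} q-odd (^q^e-lift-neg {t = t} q-odd x≡-1 e))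


module NovakPrimeDivisors where

  open import Data.Nat as ℕ using (ℕ; zero; suc; s≤s; _≤_; _%_)
  import Data.Nat.Properties as ℕ
  open import Data.Nat.Divisibility using (divides; _∣?_)
  import Data.Nat.Divisibility as ℕ
  open import Data.Nat.DivMod using ([m+kn]%n≡m%n)
  open import Data.Nat.Primality using (Prime; euclidsLemma; prime[2])
  open import Data.Nat.Coprimality using (Coprime; 0-coprimeTo-m⇒m≡1)
  import Data.Nat.Tactic.RingSolver as ℕ-Solver
  open import Data.Integer hiding (suc; pred; _≤_; _%_)
  open import Data.Integer.Properties
  open import Data.Integer.Divisibility.Signed using (∣⇒∣ᵤ; ∣ᵤ⇒∣)
  open import Data.Product using (∃-syntax; _×_; _,_)
  open import Data.Sum using (inj₁; inj₂)
  open import Relation.Nullary using (¬_; contradiction; yes; no)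
  open import Relation.Binary.PropositionalEquality
  open import Function using (case_of_)
  open Congruence
  open Divisibility
  open Fermat using (fermat-little)
  open UnitsModPrime using (units-pow≡1⇒p∸1∣)
  open QuadraticCharacterOfTwo using (2^half≡±1)

  -- b = 1 + w^(p−1) (a + p − 1), where M = pᵉ w with p ∤ w: b ≡ 1 mod w and b ≡ a mod p.
  ∃-coprime-≡mod : ∀ {p a} M → Prime p → ¬ p ℕ.∣ a → 1 ≤ M →
                   ∃[ b ] Coprime b M × + b ≡ + a mod + p
  ∃-coprime-≡mod {p} {a} M pp p∤a 1≤M with prime≥2 pp | factor-prime-power pp M 1≤M
  ... | s≤s (s≤s {n = k} _) | e , w , M≡p^e*w , p∤w = b , coprime , b≡a
    where
    c = a ℕ.+ suc k
    b = suc (w ℕ.^ suc k ℕ.* c)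
    b≡a : + b ≡ + a mod + p
    b≡a = begin
      + b                                     ≡⟨ cong (λ y → 1ℤ + y) (pos-* (w ℕ.^ suc k) c) ⟩
      1ℤ + + (w ℕ.^ suc k) * + c              ≡⟨ cong (λ y → 1ℤ + y * + c) (pos-^ w (suc k)) ⟩
      1ℤ + (+ w) ^ suc k * + c                ≈⟨ +-cong-mod (≡mod-refl {1ℤ}) w^[p∸1]*c≡c ⟩
      1ℤ + 1ℤ * + c                           ≡⟨ cong (λ y → 1ℤ + y) (*-identityˡ (+ c)) ⟩
      + suc (a ℕ.+ suc k)                     ≡⟨ cong +_ (ℕ.+-suc a (suc k)) ⟨
      + a + + p                               ≈⟨ +-modulus ⟩
      + a                                     ∎
      where
      open ≡mod-Reasoning (+ p)
      w^[p∸1]*c≡c = *-cong-mod (fermat-little pp p∤w) (≡mod-refl {+ c})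
    coprime : Coprime b M
    coprime = coprime-by-primes λ {r} pr r∣b r∣M →
      case euclidsLemma (p ℕ.^ e) w pr (subst (r ℕ.∣_) M≡p^e*w r∣M) of λ where
        (inj₁ r∣p^e) → let r≡p = prime∣prime⇒≡ pr pp (prime∣^⇒prime∣ e pr r∣p^e)
                           b≡0 = ∣⇒≡0[mod] (∣ᵤ⇒∣ (subst (ℕ._∣ b) r≡p r∣b))
                       in p∤a (∣⇒∣ᵤ (≡0[mod]⇒∣ (≡mod-trans (≡mod-sym b≡a) b≡0)))
        (inj₂ r∣w)   → prime∤1 pr (ℕ.∣m+n∣m⇒∣n (subst (r ℕ.∣_) (ℕ.+-comm 1 _) r∣b)
                                     (ℕ.∣m⇒∣m*n c (ℕ.∣m⇒∣m*n (w ℕ.^ k) r∣w)))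

  novakCarmichael⇒units-pow≡1 : ∀ {M p} → NovakCarmichael M → Prime p → p ℕ.∣ M →
                                ∀ a → ¬ p ℕ.∣ a → (+ a) ^ M ≡ 1ℤ mod + p
  novakCarmichael⇒units-pow≡1 {M} {p} (1≤M , carmichael) pp p∣M a p∤a
    with ∃-coprime-≡mod M pp p∤a 1≤M
  ... | b , b⊥M , b≡a = begin
    (+ a) ^ M      ≈⟨ ^-cong-mod M (≡mod-sym b≡a) ⟩
    (+ b) ^ M      ≡⟨ pos-^ b M ⟨
    + (b ℕ.^ M)    ≈⟨ ∣∸1⇒≡1[mod] 1≤b^M (ℕ.∣-trans p∣M (carmichael b b⊥M)) ⟩
    1ℤ             ∎
    where
    open ≡mod-Reasoning (+ p)
    1≤b : 1 ≤ b
    1≤b = ℕ.n≢0⇒n>0 λ { refl → prime∤1 pp (subst (p ℕ.∣_) (0-coprimeTo-m⇒m≡1 b⊥M) p∣M) }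
    1≤b^M : 1 ≤ b ℕ.^ M
    1≤b^M = ℕ.m^n>0 b {{ℕ.>-nonZero 1≤b}} M

  novak⇒odd : ∀ {N} → Novak N → ¬ 2 ℕ.∣ N
  novak⇒odd {suc N} (_ , N∣1+2^N) 2∣N = 1+2*-odd (2 ℕ.^ N) (ℕ.∣-trans 2∣N N∣1+2^N)

  novak⇒2^N≡-1 : ∀ {N p} → Novak N → p ℕ.∣ N → (+ 2) ^ N ≡ -1ℤ mod + p
  novak⇒2^N≡-1 {N} {p} (_ , N∣1+2^N) p∣N =
    subst (_≡ -1ℤ mod + p) (pos-^ 2 N) (∣1+⇒≡-1[mod] (ℕ.∣-trans p∣N N∣1+2^N))

  module _ {N} (novak : Novak N) (carmichael : NovakCarmichael (2 ℕ.* N)) where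

    prime-divisor-half∣ : ∀ {p} → Prime p → p ℕ.∣ N → ∃[ m ] p ≡ suc (2 ℕ.* m) × m ℕ.∣ N
    prime-divisor-half∣ pp p∣N with odd⇒≡1+2* (λ 2∣p → novak⇒odd novak (ℕ.∣-trans 2∣p p∣N))
    ... | m , refl = m , refl , ℕ.*-cancelˡ-∣ 2 (units-pow≡1⇒p∸1∣ pp (2 ℕ.* N)
                                   (novakCarmichael⇒units-pow≡1 carmichael pp (ℕ.∣n⇒∣m*n 2 p∣N)))

    prime-divisor-≡3[8] : ∀ {p} → Prime p → p ℕ.∣ N → p % 8 ≡ 3
    prime-divisor-≡3[8] {p} pp p∣N with prime-divisor-half∣ pp p∣N
    ... | m , p≡1+2m , m∣N@(divides k N≡k*m)
      with odd⇒≡1+2* (λ 2∣m → novak⇒odd novak (ℕ.∣-trans 2∣m m∣N))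
    ...   | h , m≡1+2h with 2 ∣? h
    ...     | yes (divides s refl) = trans (cong (_% 8) (trans p≡1+2m (cong (λ m → suc (2 ℕ.* m)) m≡1+2h)))
                                           (trans (cong (_% 8) (lemma s)) ([m+kn]%n≡m%n 3 s 8))
      where lemma : ∀ s → suc (2 ℕ.* suc (2 ℕ.* (s ℕ.* 2))) ≡ 3 ℕ.+ s ℕ.* 8
            lemma = ℕ-Solver.solve-∀
    ...     | no 2∤h with odd⇒≡1+2* 2∤h
    ...       | s , refl = contradiction 2∣1+2m (1+2*-odd m)
      where
      2^m≡1 : (+ 2) ^ m ≡ 1ℤ mod + p
      2^m≡1 = begin
        (+ 2) ^ m                        ≈⟨ 2^half≡±1 pp p≡1+2m m≡1+2h ⟩
        -1ℤ ^ suc (suc (2 ℕ.* s))        ≡⟨ cong (-1ℤ ^_) (ℕ.*-suc 2 s) ⟨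
        -1ℤ ^ (2 ℕ.* suc s)              ≡⟨ -1^[2k]≡1 (suc s) ⟩
        1ℤ                               ∎
        where open ≡mod-Reasoning (+ p)
      2^N≡1 : (+ 2) ^ N ≡ 1ℤ mod + p
      2^N≡1 = subst (λ n → (+ 2) ^ n ≡ 1ℤ mod + p) (trans (ℕ.*-comm m k) (sym N≡k*m))
                (^≡1⇒^*≡1 m k 2^m≡1)
      1≡-1 : 1ℤ ≡ -1ℤ mod + p
      1≡-1 = ≡mod-trans (≡mod-sym 2^N≡1) (novak⇒2^N≡-1 novak p∣N)
      p≡2 : p ≡ 2
      p≡2 = prime∣prime⇒≡ pp prime[2] (∣⇒∣ᵤ (divides-difference 1≡-1))
      2∣1+2m = subst (ℕ._∣ suc (2 ℕ.* m)) p≡2 (subst (p ℕ.∣_) p≡1+2m ℕ.∣-refl)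

    prime-divisor∈P : ∀ n {p} → Prime p → p ℕ.∣ N → P n p
    prime-divisor∈P zero    pp p∣N = pp , prime-divisor-≡3[8] pp p∣N
    prime-divisor∈P (suc n) pp p∣N with prime-divisor-half∣ pp p∣N
    ... | m , p≡1+2m , m∣N = prime-divisor∈P n pp p∣N , λ q pq q∣half →
          prime-divisor∈P n pq (ℕ.∣-trans (subst (q ℕ.∣_) ([p∸1]/2≡m p≡1+2m) q∣half) m∣N)


module Construction where

  open import Data.Nat as ℕ using (ℕ; zero; suc; s≤s; z≤n; _≤_; _<_; _∸_; _%_; _/_)
  import Data.Nat.Properties as ℕ
  import Data.Nat.Divisibility as ℕ
  open import Data.Nat.Divisibility using (divides)
  open import Data.Nat.DivMod using (m≡m%n+[m/n]*n)
  open import Data.Nat.Induction using (<-rec)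
  open import Data.Nat.Primality using (Prime; euclidsLemma; prime[2]; prime⇒nonTrivial)
  open import Data.Nat.Coprimality as Coprimality using (Coprime; coprime-divisor)
  import Data.Nat.Tactic.RingSolver as ℕ-Solver
  open import Data.Integer hiding (suc; pred; _≤_; _<_; _/_; _%_)
  open import Data.Integer.Properties
  open import Data.Product using (∃-syntax; _×_; _,_; proj₂; map₂)
  open import Data.Sum using (inj₁; inj₂)
  open import Relation.Nullary using (¬_; contradiction; yes; no)
  open import Relation.Binary.PropositionalEquality
  open import Function using (case_of_; _∘_)
  open Congruence
  open Divisibility
  open Fermat using (fermat-little)
  open QuadraticCharacterOfTwo using (2^half≡±1)
  open Lifting

  record Admissible (N : ℕ) : Set where
    field
      odd           : ¬ 2 ℕ.∣ N
      prime-divisor : ∀ {q} → Prime q → q ℕ.∣ N → q % 8 ≡ 3 × (q ∸ 1) / 2 ℕ.∣ N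

  open Admissible

  ≡3[8]⇒form : ∀ {q} → q % 8 ≡ 3 → ∃[ t ] q ≡ suc (2 ℕ.* suc (2 ℕ.* (2 ℕ.* t)))
  ≡3[8]⇒form {q} q%8≡3 =
    q / 8 , trans (m≡m%n+[m/n]*n q 8) (trans (cong (ℕ._+ q / 8 ℕ.* 8) q%8≡3) (lemma (q / 8)))
    where lemma : ∀ t → 3 ℕ.+ t ℕ.* 8 ≡ suc (2 ℕ.* suc (2 ℕ.* (2 ℕ.* t)))
          lemma = ℕ-Solver.solve-∀

  half*q^e∣N : ∀ {N q} e → Admissible N → Prime q → q ℕ.^ suc e ℕ.∣ N →
               ∃[ m ] ∃[ t ] q ≡ suc (2 ℕ.* m) × m ≡ suc (2 ℕ.* (2 ℕ.* t)) × m ℕ.* q ℕ.^ e ℕ.∣ N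
  half*q^e∣N {N} {q} e adm pq q^[1+e]∣N
    with prime-divisor adm pq (ℕ.∣-trans (ℕ.∣m⇒∣m*n (q ℕ.^ e) ℕ.∣-refl) q^[1+e]∣N)
  ... | q%8≡3 , half∣N with ≡3[8]⇒form q%8≡3
  ...   | t , q≡1+2m = m , t , q≡1+2m , refl , coprime-*-∣ m⊥q^e m∣N q^e∣N
    where
    m = suc (2 ℕ.* (2 ℕ.* t))
    q^e∣N : q ℕ.^ e ℕ.∣ N
    q^e∣N = ℕ.∣-trans (divides q refl) q^[1+e]∣N
    m∣N : m ℕ.∣ N
    m∣N = subst (ℕ._∣ N) ([p∸1]/2≡m q≡1+2m) half∣N
    q∤m : ¬ q ℕ.∣ m
    q∤m q∣m = ℕ.<⇒≱ (subst (m <_) (sym q≡1+2m) (s≤s (ℕ.m≤n*m m 2))) (ℕ.∣⇒≤ q∣m)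
    m⊥q^e : Coprime m (q ℕ.^ e)
    m⊥q^e = Coprimality.sym (coprime-prime^ e pq q∤m)

  admissible⇒≥1 : ∀ {N} → Admissible N → 1 ≤ N
  admissible⇒≥1 adm = ℕ.n≢0⇒n>0 λ { refl → odd adm (ℕ._∣0 2) }

  admissible⇒novak : ∀ {N} → Admissible N → Novak N
  admissible⇒novak {N} adm = admissible⇒≥1 adm , ∣-by-prime-powers N (admissible⇒≥1 adm) prime-power∣
    where
    prime-power∣ : ∀ {q} e → Prime q → q ℕ.^ e ℕ.∣ N → q ℕ.^ e ℕ.∣ suc (2 ℕ.^ N)
    prime-power∣ zero    _  _ = ℕ.1∣ _
    prime-power∣ {q} (suc e) pq q^[1+e]∣N with half*q^e∣N e adm pq q^[1+e]∣N
    ... | m , t , q≡1+2m , m≡1+4t , divides k N≡k*[m*q^e]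
      with odd⇒≡1+2* {k} (λ 2∣k → odd adm (ℕ.∣-trans 2∣k (subst (k ℕ.∣_) (sym N≡k*[m*q^e]) (ℕ.m∣m*n _))))
    ...   | u , refl = ≡-1[mod]⇒∣1+ (subst₂ (_≡ -1ℤ mod_) (sym (pos-^ 2 N)) (sym (pos-^ q (suc e))) 2^N≡-1)
      where
      2^m≡-1 : (+ 2) ^ m ≡ -1ℤ mod + q
      2^m≡-1 = subst (_ ≡_mod + q) (-1^[1+2k]≡-1 t) (2^half≡±1 {h = 2 ℕ.* t} pq q≡1+2m m≡1+4t)
      2^[m*q^e]≡-1 : (+ 2) ^ (m ℕ.* q ℕ.^ e) ≡ -1ℤ mod (+ q) ^ suc e
      2^[m*q^e]≡-1 = subst (_≡ -1ℤ mod _) (^-*-assoc (+ 2) m (q ℕ.^ e))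
                       (^q^e-lift-neg {t = m} q≡1+2m 2^m≡-1 e)
      2^N≡-1 : (+ 2) ^ N ≡ -1ℤ mod (+ q) ^ suc e
      2^N≡-1 = subst (λ n → (+ 2) ^ n ≡ -1ℤ mod (+ q) ^ suc e)
                 (trans (ℕ.*-comm (m ℕ.* q ℕ.^ e) _) (sym N≡k*[m*q^e]))
                 (^≡-1⇒^*odd≡-1 (m ℕ.* q ℕ.^ e) u 2^[m*q^e]≡-1)

  [q∸1]*q^e∣2N : ∀ {N q} e → Admissible N → Prime q → q ℕ.^ suc e ℕ.∣ 2 ℕ.* N →
                            (q ∸ 1) ℕ.* q ℕ.^ e ℕ.∣ 2 ℕ.* N
  [q∸1]*q^e∣2N {N} {q} e adm pq q^[1+e]∣2N with q ℕ.≟ 2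
  ... | yes refl = subst (ℕ._∣ 2 ℕ.* N) (sym (ℕ.*-identityˡ (2 ℕ.^ e)))
                         (ℕ.∣-trans (divides 2 refl) q^[1+e]∣2N)
  ... | no q≢2 with half*q^e∣N e adm pq q^[1+e]∣N
    where
    q^[1+e]∣N : q ℕ.^ suc e ℕ.∣ N
    q^[1+e]∣N = coprime-divisor (coprime-prime^ (suc e) pq (q≢2 ∘ prime∣prime⇒≡ pq prime[2])) q^[1+e]∣2N
  ...   | m , _ , refl , _ , m*q^e∣N =
    subst (ℕ._∣ 2 ℕ.* N) (sym (ℕ.*-assoc 2 m (q ℕ.^ e))) (ℕ.*-monoʳ-∣ 2 m*q^e∣N)

  admissible⇒novakCarmichael : ∀ {N} → Admissible N → NovakCarmichael (2 ℕ.* N)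
  admissible⇒novakCarmichael {N} adm =
    1≤2N , λ a a⊥2N → ∣-by-prime-powers (2 ℕ.* N) 1≤2N (prime-power∣ a a⊥2N)
    where
    1≤2N : 1 ≤ 2 ℕ.* N
    1≤2N = ℕ.≤-trans (admissible⇒≥1 adm) (ℕ.m≤m+n N (N ℕ.+ 0))
    prime-power∣ : ∀ a → Coprime a (2 ℕ.* N) →
                   ∀ {q} e → Prime q → q ℕ.^ e ℕ.∣ 2 ℕ.* N → q ℕ.^ e ℕ.∣ a ℕ.^ (2 ℕ.* N) ∸ 1
    prime-power∣ a a⊥2N zero    _  _ = ℕ.1∣ _
    prime-power∣ a a⊥2N {q} (suc e) pq q^[1+e]∣2N with [q∸1]*q^e∣2N e adm pq q^[1+e]∣2N
    ... | divides k 2N≡k*φ =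
      ≡1[mod]⇒∣∸1 1≤a^2N (subst₂ (_≡ 1ℤ mod_) (sym (pos-^ a (2 ℕ.* N))) (sym (pos-^ q (suc e))) a^2N≡1)
      where
      φ = (q ∸ 1) ℕ.* q ℕ.^ e
      q∤a : ¬ q ℕ.∣ a
      q∤a q∣a = prime∤1 pq (subst (q ℕ.∣_) (a⊥2N (q∣a , q∣2N)) ℕ.∣-refl)
        where q∣2N = ℕ.∣-trans (ℕ.∣m⇒∣m*n (q ℕ.^ e) ℕ.∣-refl) q^[1+e]∣2N
      1≤a^2N : 1 ≤ a ℕ.^ (2 ℕ.* N)
      1≤a^2N = ℕ.m^n>0 a {{ℕ.>-nonZero (ℕ.n≢0⇒n>0 λ { refl → q∤a (ℕ._∣0 q) })}} (2 ℕ.* N)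
      a^φ≡1 : (+ a) ^ φ ≡ 1ℤ mod (+ q) ^ suc e
      a^φ≡1 = subst (_≡ 1ℤ mod _) (^-*-assoc (+ a) (q ∸ 1) (q ℕ.^ e)) (^q^e-lift (fermat-little pq q∤a) e)
      a^2N≡1 : (+ a) ^ (2 ℕ.* N) ≡ 1ℤ mod (+ q) ^ suc e
      a^2N≡1 = subst (λ n → (+ a) ^ n ≡ 1ℤ mod (+ q) ^ suc e) (trans (ℕ.*-comm φ k) (sym 2N≡k*φ))
                 (^≡1⇒^*≡1 φ k a^φ≡1)

  admissible-1 : Admissible 1
  admissible-1 = record
    { odd           = prime∤1 prime[2]
    ; prime-divisor = λ pq q∣1 → contradiction q∣1 (prime∤1 pq)
    }

  admissible-* : ∀ {A B} → Admissible A → Admissible B → Admissible (A ℕ.* B)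
  admissible-* {A} {B} adm-A adm-B = record
    { odd           = λ 2∣AB → case euclidsLemma A B prime[2] 2∣AB of λ where
                        (inj₁ 2∣A) → odd adm-A 2∣A
                        (inj₂ 2∣B) → odd adm-B 2∣B
    ; prime-divisor = λ pq q∣AB → case euclidsLemma A B pq q∣AB of λ where
                        (inj₁ q∣A) → map₂ (ℕ.∣m⇒∣m*n B) (prime-divisor adm-A pq q∣A)
                        (inj₂ q∣B) → map₂ (ℕ.∣n⇒∣m*n A) (prime-divisor adm-B pq q∣B)
    }

  admissible-prime* : ∀ {r B} → Prime r → r % 8 ≡ 3 → (r ∸ 1) / 2 ℕ.∣ B → Admissible B →
                      Admissible (r ℕ.* B)
  admissible-prime* {r} {B} pr r%8≡3 half∣B adm-B = record
    { odd           = λ 2∣rB → case euclidsLemma r B prime[2] 2∣rB of λ where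
                        (inj₁ 2∣r) → let t , r≡1+2m = ≡3[8]⇒form r%8≡3
                                     in 1+2*-odd (suc (2 ℕ.* (2 ℕ.* t))) (subst (2 ℕ.∣_) r≡1+2m 2∣r)
                        (inj₂ 2∣B) → odd adm-B 2∣B
    ; prime-divisor = λ pq q∣rB → case euclidsLemma r B pq q∣rB of λ where
                        (inj₁ q∣r) → subst (λ q → q % 8 ≡ 3 × (q ∸ 1) / 2 ℕ.∣ r ℕ.* B)
                                       (sym (prime∣prime⇒≡ pq pr q∣r)) (r%8≡3 , ℕ.∣n⇒∣m*n r half∣B)
                        (inj₂ q∣B) → map₂ (ℕ.∣n⇒∣m*n r) (prime-divisor adm-B pq q∣B)
    }

  PrimeDivisorsIn : (ℕ → Set) → ℕ → Set
  PrimeDivisorsIn S m = ∀ {r} → Prime r → r ℕ.∣ m → S r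

  admissible-multiple : ∀ m → 1 ≤ m → PrimeDivisorsIn P∞ m → ∃[ N ] Admissible N × m ℕ.∣ N
  admissible-multiple = <-rec _ step
    where
    Claim : ℕ → Set
    Claim m = 1 ≤ m → PrimeDivisorsIn P∞ m → ∃[ N ] Admissible N × m ℕ.∣ N
    step : ∀ m → (∀ {k} → k < m → Claim k) → Claim m
    step 1               rec _ _      = 1 , admissible-1 , ℕ.∣-refl
    step m@(suc (suc _)) rec _ m⊆P∞ with ∃-prime-divisor {m} (s≤s (s≤s z≤n))
    ... | r , pr , r∣m@(divides m′ m≡m′*r) with ≡3[8]⇒form (proj₂ (m⊆P∞ pr r∣m 0))
    ...   | t , r≡1+2s with rec s<m (s≤s z≤n) s⊆P∞ | rec m′<m 1≤m′ m′⊆P∞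
      where
      s = suc (2 ℕ.* (2 ℕ.* t))
      s≡half = [p∸1]/2≡m r≡1+2s
      s<m : s < m
      s<m = ℕ.<-≤-trans (subst (s <_) (sym r≡1+2s) (s≤s (ℕ.m≤n*m s 2))) (ℕ.∣⇒≤ r∣m)
      s⊆P∞ : PrimeDivisorsIn P∞ s
      s⊆P∞ {q} pq q∣s n = proj₂ (m⊆P∞ pr r∣m (suc n)) q pq (subst (q ℕ.∣_) (sym s≡half) q∣s)
      1≤m′ : 1 ≤ m′
      1≤m′ = ℕ.>-nonZero⁻¹ m′ {{ℕ.quotient≢0 r∣m}}
      m′<m : m′ < m
      m′<m = ℕ.quotient-< r∣m {{prime⇒nonTrivial pr}}
      m′⊆P∞ : PrimeDivisorsIn P∞ m′
      m′⊆P∞ pq q∣m′ = m⊆P∞ pq (ℕ.∣-trans q∣m′ (divides r (trans m≡m′*r (ℕ.*-comm m′ r))))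
    ...   | N-s , adm-s , s∣N-s | N-m′ , adm-m′ , m′∣N-m′ =
      N-m′ ℕ.* (r ℕ.* N-s) ,
      admissible-* adm-m′ (admissible-prime* pr (proj₂ (m⊆P∞ pr r∣m 0)) half∣N-s adm-s) ,
      subst (ℕ._∣ N-m′ ℕ.* (r ℕ.* N-s)) (sym m≡m′*r) (ℕ.*-pres-∣ m′∣N-m′ (ℕ.m∣m*n N-s))
      where half∣N-s = subst (ℕ._∣ N-s) (sym ([p∸1]/2≡m r≡1+2s)) s∣N-s


open import Data.Nat using (ℕ; _*_)
open import Data.Nat.Divisibility using (_∣_)
open import Data.Nat.Primality using (Prime)
open import Data.Nat.Properties using (<⇒≤)
open import Data.Product using (Σ; _×_; _,_)
open import Function.Bundles using (_⇔_; mk⇔)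
open import Relation.Binary.PropositionalEquality using (subst; sym)
open Divisibility using (prime≥2; prime∣prime⇒≡)
open NovakPrimeDivisors using (prime-divisor∈P)
open Construction

theorem7 : (p : ℕ) → Prime p →
    (Σ ℕ (λ N → Novak N × NovakCarmichael (2 * N) × p ∣ N) ⇔ P∞ p)
theorem7 p pp = mk⇔
  (λ (N , novak , carmichael , p∣N) n → prime-divisor∈P novak carmichael n pp p∣N)
  (λ p∈P∞ → let N , adm , p∣N = admissible-multiple p 1≤p (prime-divisors-of-p p∈P∞)
            in N , admissible⇒novak adm , admissible⇒novakCarmichael adm , p∣N)
  where
  1≤p = <⇒≤ (prime≥2 pp)
  prime-divisors-of-p : P∞ p → PrimeDivisorsIn P∞ p
  prime-divisors-of-p p∈P∞ pr r∣p = subst P∞ (sym (prime∣prime⇒≡ pr pp r∣p)) p∈P∞
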